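{- Let $(b,a,c)$ be a Markov triple in which $a$ is the largest entry, $q$ an integer with $q\equiv 3cb^{ -1}\pmod a$, and $\lambda(a)=\frac{3+\sqrt{9-4/a^2}}{2}$. Let $D_\infty$ be the affine line through the points $(\lambda(a),0)$ and $\frac{1}{a^2\lambda(a)}(aq-1,a^2)$, i.e. the line $a^2x+\big(a^2\lambda(a)^2-(aq-1)\big)y=a^2\lambda(a)$. Then the only rational point of $D_\infty$ is $\beta=\big(\frac{q}{3a},\frac13\big)$, which is the integral barycentre of the triangle $\Delta_n^a$ with vertices $(0,0)$, $\big(\frac{c_n}{ab_n},0\big)$, $\big(\frac{(aq-1)b_n}{ac_n},\frac{ab_n}{c_n}\big)$ for every $n\in\mathbb{N}$, where $b_0=b$, $c_0=c$, $b_{n+1}=c_n$, $c_{n+1}=3ac_n-b_n$.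
   Context: A Markov triple is a triple of positive integers with $p_1^2+p_2^2+p_3^2=3p_1p_2p_3$ (entries pairwise coprime). For distinct rational points $p,p'$, $v_{p,p'}$ is the integral vector with coprime coordinates that is a positive multiple of $p'-p$; the integral bisector at a vertex $p$ of a rational triangle with other vertices $p',p''$ is the line through $p$ spanned by $v_{p,p'}+v_{p,p''}$; the three integral bisectors meet in one point, the integral barycentre. -}

module Defs where

open import Data.Nat as ℕ using (ℕ)
open import Data.Integer as ℤ using (ℤ; +_)
open import Data.Integer.Coprimality using (Coprime)
open import Data.Rational using (ℚ; _/_; _+_; _*_; _-_; _<_; 0ℚ; 1ℚ; 1/_; ≢-nonZero)
open import Data.Rational.Properties using (_≟_)
open import Data.Product using (Σ; _×_; _,_; proj₁; proj₂)
open import Relation.Nullary using (yes; no)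
open import Relation.Binary.PropositionalEquality using (_≡_)

ℤ→ℚ : ℤ → ℚ
ℤ→ℚ z = z / 1

ℕ→ℚ : ℕ → ℚ
ℕ→ℚ n = ℤ→ℚ (+ n)

-- total division on ℚ (p ÷ 0 := 0); only ever used with nonzero divisors here
_÷_ : ℚ → ℚ → ℚ
p ÷ q with q ≟ 0ℚ
... | yes _ = 0ℚ
... | no q≢0 = p * 1/_ q {{≢-nonZero q≢0}}

Point : Set
Point = ℚ × ℚ

IntVec : Set
IntVec = ℤ × ℤ

IsPrimitiveDir : Point → Point → IntVec → Set
IsPrimitiveDir (x , y) (x' , y') (v₁ , v₂) =
  Coprime v₁ v₂ ×
  Σ ℚ (λ t → (0ℚ < t) × (x' - x ≡ t * ℤ→ℚ v₁) × (y' - y ≡ t * ℤ→ℚ v₂))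

OnLine : Point → IntVec → Point → Set
OnLine (x , y) (w₁ , w₂) (zx , zy) =
  Σ ℚ (λ s → (zx - x ≡ s * ℤ→ℚ w₁) × (zy - y ≡ s * ℤ→ℚ w₂))

OnIntegralBisector : Point → Point → Point → Point → Set
OnIntegralBisector p p' p'' z =
  (v v' : IntVec) → IsPrimitiveDir p p' v → IsPrimitiveDir p p'' v' →
  OnLine p (proj₁ v ℤ.+ proj₁ v' , proj₂ v ℤ.+ proj₂ v') z

IsIntegralBarycentre : Point → Point → Point → Point → Set
IsIntegralBarycentre p₁ p₂ p₃ z =
  OnIntegralBisector p₁ p₂ p₃ z ×
  OnIntegralBisector p₂ p₃ p₁ z ×
  OnIntegralBisector p₃ p₁ p₂ z

IsMarkovTriple : ℕ → ℕ → ℕ → Set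
IsMarkovTriple p₁ p₂ p₃ =
  (0 ℕ.< p₁) × (0 ℕ.< p₂) × (0 ℕ.< p₃) ×
  (p₁ ℕ.* p₁ ℕ.+ p₂ ℕ.* p₂ ℕ.+ p₃ ℕ.* p₃ ≡ 3 ℕ.* p₁ ℕ.* p₂ ℕ.* p₃)

bcSeq : ℕ → ℕ → ℕ → ℕ → ℤ × ℤ
bcSeq b a c ℕ.zero = (+ b , + c)
bcSeq b a c (ℕ.suc n) with bcSeq b a c n
... | (bₙ , cₙ) = (cₙ , + 3 ℤ.* + a ℤ.* cₙ ℤ.- bₙ)

Δ-vertex₁ : Point
Δ-vertex₁ = (0ℚ , 0ℚ)

Δ-vertex₂ : ℕ → ℕ → ℕ → ℕ → Point
Δ-vertex₂ b a c n with bcSeq b a c n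
... | (bₙ , cₙ) = (ℤ→ℚ cₙ ÷ (ℕ→ℚ a * ℤ→ℚ bₙ) , 0ℚ)

Δ-vertex₃ : ℕ → ℕ → ℕ → ℤ → ℕ → Point
Δ-vertex₃ b a c q n with bcSeq b a c n
... | (bₙ , cₙ) =
  ( ((ℤ→ℚ q * ℕ→ℚ a - 1ℚ) * ℤ→ℚ bₙ) ÷ (ℕ→ℚ a * ℤ→ℚ cₙ)
  , (ℕ→ℚ a * ℤ→ℚ bₙ) ÷ ℤ→ℚ cₙ )

β : ℕ → ℤ → Point
β a q = (ℤ→ℚ q ÷ (ℕ→ℚ 3 * ℕ→ℚ a) , 1ℚ ÷ ℕ→ℚ 3)

-- The quadratic field ℚ(√δ) with δ = 9 - 4/a², elements r + s·√δ as pairs (r , s)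

Quad : Set
Quad = ℚ × ℚ

δ : ℕ → ℚ
δ a = ℕ→ℚ 9 - ℕ→ℚ 4 ÷ (ℕ→ℚ a * ℕ→ℚ a)

embed : ℚ → Quad
embed r = (r , 0ℚ)

_⊕_ : Quad → Quad → Quad
(r , s) ⊕ (r' , s') = (r + r' , s + s')

_⊖_ : Quad → Quad → Quad
(r , s) ⊖ (r' , s') = (r - r' , s - s')

mulQ : ℚ → Quad → Quad → Quad
mulQ d (r , s) (r' , s') = (r * r' + d * (s * s') , r * s' + s * r')

-- λ(a) = (3 + √(9 - 4/a²)) / 2
λQ : ℕ → Quad
λQ a = (ℕ→ℚ 3 ÷ ℕ→ℚ 2 , 1ℚ ÷ ℕ→ℚ 2)

OnD∞ : ℕ → ℤ → Point → Set
OnD∞ a q (x , y) =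
  let d   = δ a
      a²  = embed (ℕ→ℚ a * ℕ→ℚ a)
      λa  = λQ a
      _⊛_ = mulQ d
  in (a² ⊛ embed x) ⊕ (((a² ⊛ (λa ⊛ λa)) ⊖ embed (ℤ→ℚ q * ℕ→ℚ a - 1ℚ)) ⊛ embed y)
     ≡ a² ⊛ λa

module Submission where

-- λ(a) is a root of a²X² − 3a²X + 1, so the equation of D∞ reads
-- a²x − aq·y + (3y − 1)·a²λ(a) = 0; since λ(a) is irrational (its √δ-part is 1/2),
-- a rational point of D∞ has y = 1/3, and then x = q/(3a).
--
-- For the barycentre, the Vieta step (b, c) ↦ (c, 3ac − b) keeps (bₙ, a, cₙ) a Markov
-- triple and keeps q·bₙ ≡ 3cₙ (mod a); starting the induction needs gcd(a, c) = 1, which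
-- holds in every Markov triple by Vieta descent. Writing q·bₙ − 3cₙ = k·a, the primitive directions
-- of the edges of Δₙᵃ are (1, 0), (aq − 1, a²) and (bₙk + 1, bₙ²) up to sign, and β lies
-- on the three integral bisectors by a direct computation modulo the Markov equation.

import Data.Integer as ℤ
import Data.Nat as ℕ

module RationalArithmetic where

  open import Defs
  import Data.Integer.Properties as ℤ
  import Data.Integer.Tactic.RingSolver as ℤ
  open import Data.List using (_∷_; [])
  import Data.Nat.Coprimality as ℕ
  open import Data.Rational
    using (ℚ; mkℚ; ↥_; toℚᵘ; _+_; _*_; _-_; -_; _<_; 0ℚ; 1ℚ; 1/_; ≢-nonZero; positive)
  open import Data.Rational.Properties
  import Data.Rational.Unnormalised as ℚᵘ
  import Data.Rational.Unnormalised.Properties as ℚᵘ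
  open import Data.Empty using (⊥-elim)
  open import Function using (_∘_)
  open import Relation.Binary.PropositionalEquality
  open import Relation.Nullary using (yes; no)
  import Relation.Nullary.Decidable as Dec
  open import Tactic.RingSolver.Core.AlmostCommutativeRing
    using (AlmostCommutativeRing; fromCommutativeRing)

  ℚring : AlmostCommutativeRing _ _
  ℚring = fromCommutativeRing +-*-commutativeRing (Dec.dec⇒maybe ∘ (0ℚ ≟_))

  ℤ→ℚ≡mkℚ : ∀ z → ℤ→ℚ z ≡ mkℚ z 0 (ℕ.sym (ℕ.1-coprimeTo ℤ.∣ z ∣))
  ℤ→ℚ≡mkℚ z = ↥p/↧p≡p (mkℚ z 0 _)

  toℚᵘ-ℤ→ℚ : ∀ z → toℚᵘ (ℤ→ℚ z) ℚᵘ.≃ ℚᵘ.mkℚᵘ z 0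
  toℚᵘ-ℤ→ℚ z = ℚᵘ.≃-reflexive (cong toℚᵘ (ℤ→ℚ≡mkℚ z))

  ℤ→ℚ-homo-+ : ∀ x y → ℤ→ℚ (x ℤ.+ y) ≡ ℤ→ℚ x + ℤ→ℚ y
  ℤ→ℚ-homo-+ x y = toℚᵘ-injective (begin
    toℚᵘ (ℤ→ℚ (x ℤ.+ y))              ≈⟨ toℚᵘ-ℤ→ℚ (x ℤ.+ y) ⟩
    ℚᵘ.mkℚᵘ (x ℤ.+ y) 0                ≈⟨ ℚᵘ.*≡* cross ⟩
    ℚᵘ.mkℚᵘ x 0 ℚᵘ.+ ℚᵘ.mkℚᵘ y 0       ≈⟨ ℚᵘ.+-cong (toℚᵘ-ℤ→ℚ x) (toℚᵘ-ℤ→ℚ y) ⟨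
    toℚᵘ (ℤ→ℚ x) ℚᵘ.+ toℚᵘ (ℤ→ℚ y)    ≈⟨ toℚᵘ-homo-+ (ℤ→ℚ x) (ℤ→ℚ y) ⟨
    toℚᵘ (ℤ→ℚ x + ℤ→ℚ y)              ∎)
    where
    open ℚᵘ.≃-Reasoning
    cross : (x ℤ.+ y) ℤ.* ℤ.+ 1 ≡ (x ℤ.* ℤ.+ 1 ℤ.+ y ℤ.* ℤ.+ 1) ℤ.* ℤ.+ 1
    cross = ℤ.solve (x ∷ y ∷ [])

  ℤ→ℚ-homo-* : ∀ x y → ℤ→ℚ (x ℤ.* y) ≡ ℤ→ℚ x * ℤ→ℚ y
  ℤ→ℚ-homo-* x y = toℚᵘ-injective (begin
    toℚᵘ (ℤ→ℚ (x ℤ.* y))              ≈⟨ toℚᵘ-ℤ→ℚ (x ℤ.* y) ⟩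
    ℚᵘ.mkℚᵘ (x ℤ.* y) 0                ≈⟨ ℚᵘ.*-cong (toℚᵘ-ℤ→ℚ x) (toℚᵘ-ℤ→ℚ y) ⟨
    toℚᵘ (ℤ→ℚ x) ℚᵘ.* toℚᵘ (ℤ→ℚ y)    ≈⟨ toℚᵘ-homo-* (ℤ→ℚ x) (ℤ→ℚ y) ⟨
    toℚᵘ (ℤ→ℚ x * ℤ→ℚ y)              ∎)
    where open ℚᵘ.≃-Reasoning

  ℤ→ℚ-homo-neg : ∀ x → ℤ→ℚ (ℤ.- x) ≡ - ℤ→ℚ x
  ℤ→ℚ-homo-neg x = toℚᵘ-injective (begin
    toℚᵘ (ℤ→ℚ (ℤ.- x))                ≈⟨ toℚᵘ-ℤ→ℚ (ℤ.- x) ⟩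
    ℚᵘ.mkℚᵘ (ℤ.- x) 0                  ≈⟨ ℚᵘ.-‿cong (toℚᵘ-ℤ→ℚ x) ⟨
    ℚᵘ.- toℚᵘ (ℤ→ℚ x)                  ≈⟨ toℚᵘ-homo‿- (ℤ→ℚ x) ⟨
    toℚᵘ (- ℤ→ℚ x)                     ∎)
    where open ℚᵘ.≃-Reasoning

  ℤ→ℚ-homo-sub : ∀ x y → ℤ→ℚ (x ℤ.- y) ≡ ℤ→ℚ x - ℤ→ℚ y
  ℤ→ℚ-homo-sub x y = trans (ℤ→ℚ-homo-+ x (ℤ.- y)) (cong (ℤ→ℚ x +_) (ℤ→ℚ-homo-neg y))

  ℤ→ℚ-injective : ∀ {x y} → ℤ→ℚ x ≡ ℤ→ℚ y → x ≡ y
  ℤ→ℚ-injective {x} {y} eq = trans (↥-ℤ→ℚ x) (trans (cong ↥_ eq) (sym (↥-ℤ→ℚ y)))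
    where
    ↥-ℤ→ℚ : ∀ z → z ≡ ↥ ℤ→ℚ z
    ↥-ℤ→ℚ z = cong ↥_ (sym (ℤ→ℚ≡mkℚ z))

  ℤ→ℚ-pos : ∀ {z} → ℤ.0ℤ ℤ.< z → 0ℚ < ℤ→ℚ z
  ℤ→ℚ-pos {z} 0<z = subst (0ℚ <_) (sym (ℤ→ℚ≡mkℚ z)) (positive⁻¹ _ {{ℤ.positive 0<z}})

  ℕ→ℚ-pos : ∀ {n} → 0 ℕ.< n → 0ℚ < ℕ→ℚ n
  ℕ→ℚ-pos {n} 0<n = ℤ→ℚ-pos {ℤ.+ n} (ℤ.+<+ 0<n)

  0<3 : 0ℚ < ℕ→ℚ 3
  0<3 = ℕ→ℚ-pos {3} (ℕ.s≤s ℕ.z≤n)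

  pos⇒≢0 : ∀ {p} → 0ℚ < p → p ≢ 0ℚ
  pos⇒≢0 0<p = ≢-sym (<⇒≢ 0<p)

  *-pos : ∀ {p q} → 0ℚ < p → 0ℚ < q → 0ℚ < p * q
  *-pos {p} {q} 0<p 0<q = positive⁻¹ _ {{pos*pos⇒pos p {{positive 0<p}} q {{positive 0<q}}}}

  *-cancelʳ-≡ : ∀ {p q} r → r ≢ 0ℚ → p * r ≡ q * r → p ≡ q
  *-cancelʳ-≡ {p} {q} r r≢0 eq = begin
    p                ≡⟨ *-identityʳ p ⟨
    p * 1ℚ           ≡⟨ cong (p *_) (*-inverseʳ r) ⟨
    p * (r * 1/ r)   ≡⟨ *-assoc p r (1/ r) ⟨
    p * r * 1/ r     ≡⟨ cong (_* 1/ r) eq ⟩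
    q * r * 1/ r     ≡⟨ *-assoc q r (1/ r) ⟩
    q * (r * 1/ r)   ≡⟨ cong (q *_) (*-inverseʳ r) ⟩
    q * 1ℚ           ≡⟨ *-identityʳ q ⟩
    q                ∎
    where
    open ≡-Reasoning
    instance _ = ≢-nonZero r≢0

  p÷q*q≡p : ∀ p {q} → q ≢ 0ℚ → (p ÷ q) * q ≡ p
  p÷q*q≡p p {q} q≢0 with q ≟ 0ℚ
  ... | yes q≡0 = ⊥-elim (q≢0 q≡0)
  ... | no q≢0′ = trans (*-assoc p _ q)
                    (trans (cong (p *_) (*-inverseˡ q {{≢-nonZero q≢0′}})) (*-identityʳ p))

  ÷-pos : ∀ {p q} → 0ℚ < p → 0ℚ < q → 0ℚ < p ÷ q
  ÷-pos {p} {q} 0<p 0<q with q ≟ 0ℚ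
  ... | yes q≡0 = ⊥-elim (pos⇒≢0 0<q q≡0)
  ... | no _    = *-pos 0<p (positive⁻¹ _ {{1/pos⇒pos q {{positive 0<q}}}})

  *≡⇒≡÷ : ∀ {x} n {d} → d ≢ 0ℚ → x * d ≡ n → x ≡ n ÷ d
  *≡⇒≡÷ n {d} d≢0 eq = *-cancelʳ-≡ d d≢0 (trans eq (sym (p÷q*q≡p n d≢0)))

  *≡*⇒≡÷* : ∀ {x} n {d} w → d ≢ 0ℚ → x * d ≡ n * w → x ≡ (n ÷ d) * w
  *≡*⇒≡÷* {x} n {d} w d≢0 eq = *-cancelʳ-≡ d d≢0 (begin
    x * d                ≡⟨ eq ⟩
    n * w                ≡⟨ cong (_* w) (p÷q*q≡p n d≢0) ⟨
    (n ÷ d) * d * w      ≡⟨ *-assoc (n ÷ d) d w ⟩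
    (n ÷ d) * (d * w)    ≡⟨ cong ((n ÷ d) *_) (*-comm d w) ⟩
    (n ÷ d) * (w * d)    ≡⟨ *-assoc (n ÷ d) w d ⟨
    (n ÷ d) * w * d      ∎)
    where open ≡-Reasoning

module PrimitiveDirections where

  open import Defs
  open RationalArithmetic
  open import Data.Integer.Coprimality using (Coprime; coprime-divisor)
  import Data.Integer.Divisibility.Signed as ℤ∣
  import Data.Integer.Properties as ℤ
  open import Data.List using (_∷_; [])
  import Data.Nat.Coprimality as ℕ
  import Data.Nat.Divisibility as ℕ
  import Data.Nat.Properties as ℕ
  open import Data.Product using (_×_; _,_; proj₁; proj₂)
  open import Data.Rational using (ℚ; _+_; _*_; _-_; -_; _<_; 0ℚ)
  open import Data.Rational.Properties using (+-mono-<; neg-distribʳ-*)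
  open import Relation.Binary.PropositionalEquality
  open import Relation.Nullary using (contradiction)
  open import Tactic.RingSolver using (solve)

  coprime-* : ∀ {m n o} → ℕ.Coprime m n → ℕ.Coprime m o → ℕ.Coprime m (n ℕ.* o)
  coprime-* {n = n} m⊥n m⊥o (d∣m , d∣no) = m⊥o (d∣m , ℕ.coprime-divisor d⊥n d∣no)
    where
    d⊥n : ℕ.Coprime _ n
    d⊥n (e∣d , e∣n) = m⊥n (ℕ.∣-trans e∣d d∣m , e∣n)

  coprime[x*y+e,x*x] : ∀ x y e → ℤ.∣ e ∣ ≡ 1 → Coprime (x ℤ.* y ℤ.+ e) (x ℤ.* x)
  coprime[x*y+e,x*x] x y e ∣e∣≡1 =
    subst (ℕ.Coprime ℤ.∣ x ℤ.* y ℤ.+ e ∣) (sym (ℤ.abs-* x x)) (coprime-* ⊥x ⊥x)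
    where
    ⊥x : Coprime (x ℤ.* y ℤ.+ e) x
    ⊥x {i} (i∣xy+e , i∣x) = ℕ.∣1⇒≡1 (subst (i ℕ.∣_) ∣e∣≡1 (ℤ∣.∣⇒∣ᵤ
      (ℤ∣.∣m+n∣m⇒∣n (ℤ∣.∣ᵤ⇒∣ i∣xy+e) (ℤ∣.∣m⇒∣m*n y (ℤ∣.∣ᵤ⇒∣ {ℤ.+ i} {x} i∣x)))))

  coprime-cross⇒∣ : ∀ m n {k l} → Coprime m n → m ℤ.* k ≡ n ℤ.* l → ℤ.∣ m ∣ ℕ.∣ ℤ.∣ l ∣
  coprime-cross⇒∣ m n {k} {l} m⊥n mk≡nl = coprime-divisor m n l m⊥n
    (ℤ∣.∣⇒∣ᵤ (ℤ∣.divides k (trans (sym mk≡nl) (ℤ.*-comm m k))))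

  coprime-cross⇒abs≡ : ∀ v₁ v₂ w₁ w₂ → Coprime v₁ v₂ → Coprime w₁ w₂ → v₁ ℤ.* w₂ ≡ v₂ ℤ.* w₁ →
                       ℤ.∣ v₁ ∣ ≡ ℤ.∣ w₁ ∣ × ℤ.∣ v₂ ∣ ≡ ℤ.∣ w₂ ∣
  coprime-cross⇒abs≡ v₁ v₂ w₁ w₂ v₁⊥v₂ w₁⊥w₂ cross =
    ℕ.∣-antisym (coprime-cross⇒∣ v₁ v₂ v₁⊥v₂ cross) (coprime-cross⇒∣ w₁ w₂ w₁⊥w₂ cross′) ,
    ℕ.∣-antisym (coprime-cross⇒∣ v₂ v₁ (ℕ.sym v₁⊥v₂) (sym cross))
                (coprime-cross⇒∣ w₂ w₁ (ℕ.sym w₁⊥w₂) (sym cross′))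
    where
    cross′ : w₁ ℤ.* v₂ ≡ w₂ ℤ.* v₁
    cross′ = trans (ℤ.*-comm w₁ v₂) (trans (sym cross) (ℤ.*-comm v₁ w₂))

  proportional⇒cross≡ : ∀ {t s} V₁ V₂ W₁ W₂ → 0ℚ < t → 0ℚ < s →
                        t * V₁ ≡ s * W₁ → t * V₂ ≡ s * W₂ → V₁ * W₂ ≡ V₂ * W₁
  proportional⇒cross≡ {t} {s} V₁ V₂ W₁ W₂ 0<t 0<s e₁ e₂ =
    *-cancelʳ-≡ (t * s) (pos⇒≢0 (*-pos 0<t 0<s)) (begin
      V₁ * W₂ * (t * s)     ≡⟨ solve (V₁ ∷ W₂ ∷ t ∷ s ∷ []) ℚring ⟩
      (t * V₁) * (s * W₂)   ≡⟨ cong₂ _*_ e₁ (sym e₂) ⟩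
      (s * W₁) * (t * V₂)   ≡⟨ solve (s ∷ W₁ ∷ t ∷ V₂ ∷ []) ℚring ⟩
      V₂ * W₁ * (t * s)     ∎)
    where open ≡-Reasoning

  opposite⇒0 : ∀ {t s} V → 0ℚ < t → 0ℚ < s → t * V ≡ s * (- V) → V ≡ 0ℚ
  opposite⇒0 {t} {s} V 0<t 0<s eq = *-cancelʳ-≡ (t + s) (pos⇒≢0 (+-mono-< 0<t 0<s)) (begin
    V * (t + s)              ≡⟨ solve (V ∷ t ∷ s ∷ []) ℚring ⟩
    t * V - s * (- V)        ≡⟨ cong (_- s * (- V)) eq ⟩
    s * (- V) - s * (- V)    ≡⟨ solve (s ∷ V ∷ t ∷ []) ℚring ⟩
    0ℚ * (t + s)             ∎)
    where open ≡-Reasoning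

  same-sign-abs⇒≡ : ∀ {t s} v w → 0ℚ < t → 0ℚ < s → t * ℤ→ℚ v ≡ s * ℤ→ℚ w →
                    ℤ.∣ v ∣ ≡ ℤ.∣ w ∣ → v ≡ w
  same-sign-abs⇒≡ (ℤ.+ _) (ℤ.+ _) _ _ _ eq = cong ℤ.+_ eq
  same-sign-abs⇒≡ ℤ.-[1+ _ ] ℤ.-[1+ _ ] _ _ _ eq = cong ℤ.-[1+_] (ℕ.suc-injective eq)
  same-sign-abs⇒≡ {s = s} (ℤ.+ _) ℤ.-[1+ n ] 0<t 0<s eq refl = contradiction
    (ℤ→ℚ-injective {ℤ.+[1+ n ]} {ℤ.0ℤ}
      (opposite⇒0 _ 0<t 0<s (trans eq (cong (s *_) (ℤ→ℚ-homo-neg ℤ.+[1+ n ])))))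
    λ ()
  same-sign-abs⇒≡ {t = t} ℤ.-[1+ n ] (ℤ.+ _) 0<t 0<s eq refl = contradiction
    (ℤ→ℚ-injective {ℤ.+[1+ n ]} {ℤ.0ℤ}
      (opposite⇒0 _ 0<s 0<t (trans (sym eq) (cong (t *_) (ℤ→ℚ-homo-neg ℤ.+[1+ n ])))))
    λ ()

  primitiveDir-unique : ∀ p p′ {v w} → IsPrimitiveDir p p′ v → IsPrimitiveDir p p′ w → v ≡ w
  primitiveDir-unique _ _ {v₁ , v₂} {w₁ , w₂} (v₁⊥v₂ , t , 0<t , ex , ey) (w₁⊥w₂ , s , 0<s , ex′ , ey′) =
    cong₂ _,_ (same-sign-abs⇒≡ v₁ w₁ 0<t 0<s (trans (sym ex) ex′) (proj₁ same-abs))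
              (same-sign-abs⇒≡ v₂ w₂ 0<t 0<s (trans (sym ey) ey′) (proj₂ same-abs))
    where
    open ≡-Reasoning
    cross : v₁ ℤ.* w₂ ≡ v₂ ℤ.* w₁
    cross = ℤ→ℚ-injective (begin
      ℤ→ℚ (v₁ ℤ.* w₂)    ≡⟨ ℤ→ℚ-homo-* v₁ w₂ ⟩
      ℤ→ℚ v₁ * ℤ→ℚ w₂    ≡⟨ proportional⇒cross≡ _ _ _ _ 0<t 0<s (trans (sym ex) ex′)
                                                                 (trans (sym ey) ey′) ⟩
      ℤ→ℚ v₂ * ℤ→ℚ w₁    ≡⟨ ℤ→ℚ-homo-* v₂ w₁ ⟨
      ℤ→ℚ (v₂ ℤ.* w₁)    ∎)
    same-abs = coprime-cross⇒abs≡ v₁ v₂ w₁ w₂ v₁⊥v₂ w₁⊥w₂ cross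

  opposite : IntVec → IntVec
  opposite (v₁ , v₂) = (ℤ.- v₁ , ℤ.- v₂)

  primitiveDir-flip : ∀ p p′ {v} → IsPrimitiveDir p p′ v → IsPrimitiveDir p′ p (opposite v)
  primitiveDir-flip (x , y) (x′ , y′) {v₁ , v₂} (v₁⊥v₂ , t , 0<t , ex , ey) =
    subst₂ ℕ.Coprime (sym (ℤ.∣-i∣≡∣i∣ v₁)) (sym (ℤ.∣-i∣≡∣i∣ v₂)) v₁⊥v₂ ,
    t , 0<t , flip x x′ v₁ ex , flip y y′ v₂ ey
    where
    flip : ∀ u u′ w → u′ - u ≡ t * ℤ→ℚ w → u - u′ ≡ t * ℤ→ℚ (ℤ.- w)
    flip u u′ w eq = begin
      u - u′            ≡⟨ solve (u ∷ u′ ∷ []) ℚring ⟩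
      - (u′ - u)        ≡⟨ cong -_ eq ⟩
      - (t * ℤ→ℚ w)     ≡⟨ neg-distribʳ-* t (ℤ→ℚ w) ⟩
      t * - ℤ→ℚ w       ≡⟨ cong (t *_) (ℤ→ℚ-homo-neg w) ⟨
      t * ℤ→ℚ (ℤ.- w)   ∎
      where open ≡-Reasoning

  onIntegralBisector-intro : ∀ p p′ p″ z {v v′} (s : ℚ) →
    IsPrimitiveDir p p′ v → IsPrimitiveDir p p″ v′ →
    proj₁ z - proj₁ p ≡ s * (ℤ→ℚ (proj₁ v) + ℤ→ℚ (proj₁ v′)) →
    proj₂ z - proj₂ p ≡ s * (ℤ→ℚ (proj₂ v) + ℤ→ℚ (proj₂ v′)) →
    OnIntegralBisector p p′ p″ z
  onIntegralBisector-intro p p′ p″ z {v} {v′} s dir dir′ ex ey u u′ dir-u dir-u′ =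
    subst₂ (λ u u′ → OnLine p (proj₁ u ℤ.+ proj₁ u′ , proj₂ u ℤ.+ proj₂ u′) z)
      (primitiveDir-unique p p′ {v} {u} dir dir-u) (primitiveDir-unique p p″ {v′} {u′} dir′ dir-u′)
      on-line
    where
    on-line : OnLine p (proj₁ v ℤ.+ proj₁ v′ , proj₂ v ℤ.+ proj₂ v′) z
    on-line = s , trans ex (cong (s *_) (sym (ℤ→ℚ-homo-+ (proj₁ v) (proj₁ v′))))
                , trans ey (cong (s *_) (sym (ℤ→ℚ-homo-+ (proj₂ v) (proj₂ v′))))

module MarkovTriples where

  open import Defs
  open import Data.Nat
  open import Data.Nat.Coprimality using (Coprime; 1-coprimeTo)
  import Data.Nat.Coprimality as Coprime
  open import Data.Nat.Divisibility using (_∣_; ∣m+n∣m⇒∣n; ∣-trans; n∣m*n; n∣m*n*o)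
  open import Data.Nat.Properties
  open import Data.Nat.Tactic.RingSolver using (solve)
  open import Data.List using (_∷_; [])
  open import Data.Product using (Σ; _×_; _,_)
  open import Data.Sum using (_⊎_; inj₁; inj₂)
  open import Relation.Binary.PropositionalEquality
  open import Relation.Nullary using (contradiction; yes; no)

  PairwiseCoprime : ℕ → ℕ → ℕ → Set
  PairwiseCoprime x y z = Coprime x y × Coprime y z × Coprime z x

  pairwiseCoprime-unrotate : ∀ {x y z} → PairwiseCoprime y z x → PairwiseCoprime x y z
  pairwiseCoprime-unrotate (y⊥z , z⊥x , x⊥y) = x⊥y , y⊥z , z⊥x

  markov-rotate : ∀ {x y z} → IsMarkovTriple x y z → IsMarkovTriple y z x
  markov-rotate {x} {y} {z} (0<x , 0<y , 0<z , eq) = 0<y , 0<z , 0<x , (begin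
    y * y + z * z + x * x   ≡⟨ solve (x ∷ y ∷ z ∷ []) ⟩
    x * x + y * y + z * z   ≡⟨ eq ⟩
    3 * x * y * z           ≡⟨ solve (x ∷ y ∷ z ∷ []) ⟩
    3 * y * z * x           ∎)
    where open ≡-Reasoning

  sum-rotate : ∀ x y z → y + z + x ≡ x + y + z
  sum-rotate x y z = solve (x ∷ y ∷ z ∷ [])

  m*[n+o]≤n*o+m*m : ∀ {m n o} → m ≤ n → m ≤ o → m * (n + o) ≤ n * o + m * m
  m*[n+o]≤n*o+m*m {m} m≤n m≤o with m≤n⇒∃[o]m+o≡n m≤n | m≤n⇒∃[o]m+o≡n m≤o
  ... | d , refl | e , refl = begin
    m * ((m + d) + (m + e))             ≤⟨ m≤m+n _ (d * e) ⟩
    m * ((m + d) + (m + e)) + d * e     ≡⟨ solve (m ∷ d ∷ e ∷ []) ⟩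
    (m + d) * (m + e) + m * m           ∎
    where open ≤-Reasoning

  -- If z ≤ z′ then (z − y)(z′ − y) ≥ 0 gives 3xy² ≤ x² + 2y², which with x ≤ y forces
  -- x = y = 1, and then z′z = 2 contradicts z′, z ≥ 2.
  vieta-partner-< : ∀ {x y z z′} → 0 < x → x ≤ y → y ≤ z → 2 ≤ z →
                    x * x + y * y ≡ z′ * z → z′ + z ≡ 3 * x * y → z′ < z
  vieta-partner-< {x} {y} {z} {z′} 0<x x≤y y≤z 2≤z prod sum = ≰⇒> z≰z′
    where
    z≰z′ : z ≰ z′
    z≰z′ z≤z′ = contradiction (begin
      2 * 2           ≤⟨ *-mono-≤ (≤-trans 2≤z z≤z′) 2≤z ⟩
      z′ * z          ≡⟨ prod ⟨
      x * x + y * y   ≡⟨ cong₂ (λ x y → x * x + y * y) x≡1 y≡1 ⟩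
      2               ∎) λ { (s≤s (s≤s ())) }
      where
      open ≤-Reasoning
      0<y = ≤-trans 0<x x≤y
      instance
        _ = >-nonZero 0<y
        _ = m*n≢0 3 (y * y) {{_}} {{m*n≢0 y y}}
      bound : y * (3 * x * y) ≤ x * x + y * y + y * y
      bound = subst₂ (λ s p → y * s ≤ p + y * y) sum (sym prod)
                     (m*[n+o]≤n*o+m*m (≤-trans y≤z z≤z′) y≤z)
      x≡1 : x ≡ 1
      x≡1 = ≤-antisym (*-cancelʳ-≤ x 1 (3 * (y * y)) (begin
        x * (3 * (y * y))       ≡⟨ solve (x ∷ y ∷ []) ⟩
        y * (3 * x * y)         ≤⟨ bound ⟩
        x * x + y * y + y * y   ≤⟨ +-monoˡ-≤ _ (+-monoˡ-≤ _ (*-mono-≤ x≤y x≤y)) ⟩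
        y * y + y * y + y * y   ≡⟨ solve (y ∷ []) ⟩
        1 * (3 * (y * y))       ∎)) 0<x
      y≡1 : y ≡ 1
      y≡1 = ≤-antisym (≤-trans (m≤m*n y y) (+-cancelˡ-≤ (y * y + y * y) _ _ (begin
        y * y + y * y + y * y   ≡⟨ solve (y ∷ []) ⟩
        y * (3 * 1 * y)         ≡⟨ cong (λ x → y * (3 * x * y)) x≡1 ⟨
        y * (3 * x * y)         ≤⟨ bound ⟩
        x * x + y * y + y * y   ≡⟨ cong (λ x → x * x + y * y + y * y) x≡1 ⟩
        1 * 1 + y * y + y * y   ≡⟨ solve (y ∷ []) ⟩
        y * y + y * y + 1       ∎))) 0<y

  vieta-jump : ∀ {x y z} → IsMarkovTriple x y z → x ≤ z → y ≤ z → 2 ≤ z →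
               Σ ℕ λ z′ → z + z′ ≡ 3 * x * y × z′ < z × IsMarkovTriple x y z′
  vieta-jump {x} {y} {z} (0<x , 0<y , 0<z , eq) x≤z y≤z 2≤z =
    z′ , sum , z′<z , 0<x , 0<y , 0<z′ , eq′
    where
    open ≡-Reasoning
    instance _ = >-nonZero 0<z
    z≤3xy : z ≤ 3 * x * y
    z≤3xy = *-cancelʳ-≤ z (3 * x * y) z (≤-trans (m≤n+m (z * z) (x * x + y * y)) (≤-reflexive eq))
    z′ = 3 * x * y ∸ z
    sum : z + z′ ≡ 3 * x * y
    sum = trans (+-comm z z′) (m∸n+n≡m z≤3xy)
    prod : x * x + y * y ≡ z′ * z
    prod = +-cancelʳ-≡ (z * z) _ _ (begin
      x * x + y * y + z * z   ≡⟨ eq ⟩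
      3 * x * y * z           ≡⟨ cong (_* z) sum ⟨
      (z + z′) * z            ≡⟨ *-distribʳ-+ z z z′ ⟩
      z * z + z′ * z          ≡⟨ +-comm (z * z) (z′ * z) ⟩
      z′ * z + z * z          ∎)
    eq′ : x * x + y * y + z′ * z′ ≡ 3 * x * y * z′
    eq′ = begin
      x * x + y * y + z′ * z′   ≡⟨ cong (_+ z′ * z′) prod ⟩
      z′ * z + z′ * z′          ≡⟨ *-distribˡ-+ z′ z z′ ⟨
      z′ * (z + z′)             ≡⟨ cong (z′ *_) sum ⟩
      z′ * (3 * x * y)          ≡⟨ *-comm z′ (3 * x * y) ⟩
      3 * x * y * z′            ∎
    0<z′ : 0 < z′
    0<z′ = n≢0⇒n>0 λ z′≡0 → <⇒≢ (≤-trans (*-mono-≤ 0<x 0<x) (m≤m+n (x * x) (y * y)))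
                                    (sym (trans prod (cong (_* z) z′≡0)))
    z′<z : z′ < z
    z′<z with ≤-total x y
    ... | inj₁ x≤y = vieta-partner-< 0<x x≤y y≤z 2≤z prod (trans (+-comm z′ z) sum)
    ... | inj₂ y≤x = vieta-partner-< 0<y y≤x x≤z 2≤z (trans (+-comm (y * y) (x * x)) prod)
                                     (trans (+-comm z′ z) (trans sum (solve (x ∷ y ∷ []))))

  coprime-partner : ∀ {w z z′} → w ∣ z + z′ → Coprime w z′ → Coprime w z
  coprime-partner w∣z+z′ w⊥z′ (d∣w , d∣z) = w⊥z′ (d∣w , ∣m+n∣m⇒∣n (∣-trans d∣w w∣z+z′) d∣z)

  ≤1⇒coprime : ∀ {x m} → 0 < x → x ≤ 1 → Coprime x m
  ≤1⇒coprime {suc zero}    _ _        = 1-coprimeTo _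
  ≤1⇒coprime {suc (suc _)} _ (s≤s ())

  MarkovCoprimeBelow : ℕ → Set
  MarkovCoprimeBelow n = ∀ {x y z} → x + y + z ≤ n → IsMarkovTriple x y z → PairwiseCoprime x y z

  markov-coprime-at-max : ∀ {n x y z} → MarkovCoprimeBelow n → x + y + z ≤ suc n →
                          x ≤ z → y ≤ z → IsMarkovTriple x y z → PairwiseCoprime x y z
  markov-coprime-at-max {n} {x} {y} {z} below sum≤ x≤z y≤z m@(0<x , 0<y , 0<z , _) with z ≤? 1
  ... | yes z≤1 =
    ≤1⇒coprime 0<x (≤-trans x≤z z≤1) , ≤1⇒coprime 0<y (≤-trans y≤z z≤1) , ≤1⇒coprime 0<z z≤1
  ... | no z≰1 with vieta-jump m x≤z y≤z (≰⇒> z≰1)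
  ...   | z′ , z+z′≡3xy , z′<z , m′ with below (≤-pred (≤-trans (+-monoʳ-< (x + y) z′<z) sum≤)) m′
  ...     | x⊥y , y⊥z′ , z′⊥x =
    x⊥y ,
    coprime-partner (subst (y ∣_) (sym z+z′≡3xy) (n∣m*n (3 * x))) y⊥z′ ,
    Coprime.sym (coprime-partner (subst (x ∣_) (sym z+z′≡3xy) (n∣m*n*o 3 y)) (Coprime.sym z′⊥x))

  max-cases : ∀ x y z → (x ≤ z × y ≤ z) ⊎ (y ≤ x × z ≤ x) ⊎ (z ≤ y × x ≤ y)
  max-cases x y z with ≤-total x z | ≤-total y z | ≤-total x y
  ... | inj₁ x≤z | inj₁ y≤z | _        = inj₁ (x≤z , y≤z)
  ... | inj₁ x≤z | inj₂ z≤y | _        = inj₂ (inj₂ (z≤y , ≤-trans x≤z z≤y))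
  ... | inj₂ z≤x | _        | inj₁ x≤y = inj₂ (inj₂ (≤-trans z≤x x≤y , x≤y))
  ... | inj₂ z≤x | _        | inj₂ y≤x = inj₂ (inj₁ (y≤x , z≤x))

  markov-coprime-below : ∀ n → MarkovCoprimeBelow n
  markov-coprime-below zero {x} {y} {z} sum≤0 (0<x , _) =
    contradiction (≤-trans 0<x (≤-trans (m≤m+n x y) (≤-trans (m≤m+n (x + y) z) sum≤0))) λ ()
  markov-coprime-below (suc n) {x} {y} {z} sum≤ m with max-cases x y z
  ... | inj₁ (x≤z , y≤z) = markov-coprime-at-max (markov-coprime-below n) sum≤ x≤z y≤z m
  ... | inj₂ (inj₁ (y≤x , z≤x)) = pairwiseCoprime-unrotate
    (markov-coprime-at-max (markov-coprime-below n) (subst (_≤ suc n) (sym (sum-rotate x y z)) sum≤)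
      y≤x z≤x (markov-rotate m))
  ... | inj₂ (inj₂ (z≤y , x≤y)) = pairwiseCoprime-unrotate (pairwiseCoprime-unrotate
    (markov-coprime-at-max (markov-coprime-below n) (subst (_≤ suc n) (sum-rotate z x y) sum≤)
      z≤y x≤y (markov-rotate (markov-rotate m))))

  markov-pairwiseCoprime : ∀ {x y z} → IsMarkovTriple x y z → PairwiseCoprime x y z
  markov-pairwiseCoprime {x} {y} {z} = markov-coprime-below (x + y + z) ≤-refl

module MarkovSequence where

  open import Defs
  open MarkovTriples using (markov-pairwiseCoprime)
  open import Data.Integer
  open import Data.Integer.Properties
  open import Data.Integer.Tactic.RingSolver using (solve)
  import Data.Integer.Coprimality as ℤ
  import Data.Integer.Divisibility as Unsigned
  open import Data.Integer.Divisibility.Signed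
  import Data.Nat.Tactic.RingSolver as ℕ
  open import Data.List using (_∷_; [])
  open import Data.Product using (_,_; proj₁; proj₂)
  open import Relation.Binary.PropositionalEquality

  square-nonNeg : ∀ i → 0ℤ ≤ i * i
  square-nonNeg (+ n)    = subst (0ℤ ≤_) (sym (+◃n≡+n (n ℕ.* n))) (+≤+ ℕ.z≤n)
  square-nonNeg -[1+ n ] = +≤+ ℕ.z≤n

  square-pos : ∀ {i} → 0ℤ < i → 0ℤ < i * i
  square-pos {i} 0<i = subst (_< i * i) (*-zeroʳ i) (*-monoˡ-<-pos i {{positive 0<i}} 0<i)

  vieta-partner-pos : ∀ {a b c c′} → 0ℤ < b → 0ℤ < c → b * c′ ≡ a * a + c * c → 0ℤ < c′
  vieta-partner-pos {a} {b} {c} {c′} 0<b 0<c bc′≡ =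
    *-cancelˡ-<-nonNeg b {{nonNegative (<⇒≤ 0<b)}} (begin-strict
      b * 0ℤ          ≡⟨ *-zeroʳ b ⟩
      0ℤ              <⟨ +-mono-≤-< (square-nonNeg a) (square-pos 0<c) ⟩
      a * a + c * c   ≡⟨ bc′≡ ⟨
      b * c′          ∎)
    where open ≤-Reasoning

  -- The second congruence is the first one for the next pair (c , 3ac − b).
  record Admissible (a q b c : ℤ) : Set where
    field
      b-pos   : 0ℤ < b
      c-pos   : 0ℤ < c
      markov  : a * a + b * b + c * c ≡ + 3 * a * b * c
      a∣qb-3c : a ∣ q * b - + 3 * c
      a∣qc+3b : a ∣ q * c + + 3 * b

  admissible-step : ∀ {a q b c} → Admissible a q b c → Admissible a q c (+ 3 * a * c - b)
  admissible-step {a} {q} {b} {c} adm = record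
    { b-pos   = c-pos
    ; c-pos   = vieta-partner-pos {a} b-pos c-pos vieta
    ; markov  = markov′
    ; a∣qb-3c = subst (a ∣_) shift₁ (∣m∣n⇒∣m-n a∣qc+3b (∣m⇒∣m*n (+ 9 * c) ∣-refl))
    ; a∣qc+3b = subst (a ∣_) shift₂ (∣m∣n⇒∣m-n (∣m⇒∣m*n (+ 3 * q * c) ∣-refl) a∣qb-3c)
    }
    where
    open Admissible adm
    open ≡-Reasoning
    c′ = + 3 * a * c - b
    vieta : b * c′ ≡ a * a + c * c
    vieta = begin
      b * (+ 3 * a * c - b)
        ≡⟨ solve (a ∷ b ∷ c ∷ []) ⟩
      + 3 * a * b * c - (a * a + b * b + c * c) + a * a + c * c
        ≡⟨ cong (λ m → + 3 * a * b * c - m + a * a + c * c) markov ⟩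
      + 3 * a * b * c - + 3 * a * b * c + a * a + c * c
        ≡⟨ solve (a ∷ b ∷ c ∷ []) ⟩
      a * a + c * c ∎
    markov′ : a * a + c * c + c′ * c′ ≡ + 3 * a * c * c′
    markov′ = begin
      a * a + c * c + (+ 3 * a * c - b) * (+ 3 * a * c - b)
        ≡⟨ solve (a ∷ b ∷ c ∷ []) ⟩
      a * a + c * c + + 3 * a * c * (+ 3 * a * c - b) - b * (+ 3 * a * c - b)
        ≡⟨ cong (λ m → a * a + c * c + + 3 * a * c * c′ - m) vieta ⟩
      a * a + c * c + + 3 * a * c * (+ 3 * a * c - b) - (a * a + c * c)
        ≡⟨ solve (a ∷ b ∷ c ∷ []) ⟩
      + 3 * a * c * (+ 3 * a * c - b) ∎
    shift₁ : q * c + + 3 * b - a * (+ 9 * c) ≡ q * c - + 3 * (+ 3 * a * c - b)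
    shift₁ = solve (a ∷ q ∷ b ∷ c ∷ [])
    shift₂ : a * (+ 3 * q * c) - (q * b - + 3 * c) ≡ q * (+ 3 * a * c - b) + + 3 * c
    shift₂ = solve (a ∷ q ∷ b ∷ c ∷ [])

  a∣c[qc+3b] : ∀ {a q b c} → a * a + b * b + c * c ≡ + 3 * a * b * c →
               a ∣ q * b - + 3 * c → a ∣ c * (q * c + + 3 * b)
  a∣c[qc+3b] {a} {q} {b} {c} markov a∣qb-3c =
    subst (a ∣_) eq (∣m∣n⇒∣m-n (∣m⇒∣m*n (q * (+ 3 * b * c) - q * a) ∣-refl) (∣n⇒∣m*n b a∣qb-3c))
    where
    open ≡-Reasoning
    eq : a * (q * (+ 3 * b * c) - q * a) - b * (q * b - + 3 * c) ≡ c * (q * c + + 3 * b)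
    eq = begin
      a * (q * (+ 3 * b * c) - q * a) - b * (q * b - + 3 * c)
        ≡⟨ solve (a ∷ q ∷ b ∷ c ∷ []) ⟩
      q * (+ 3 * a * b * c) - q * (a * a + b * b + c * c) + c * (q * c + + 3 * b)
        ≡⟨ cong (λ m → q * (+ 3 * a * b * c) - q * m + c * (q * c + + 3 * b)) markov ⟩
      q * (+ 3 * a * b * c) - q * (+ 3 * a * b * c) + c * (q * c + + 3 * b)
        ≡⟨ solve (a ∷ q ∷ b ∷ c ∷ []) ⟩
      c * (q * c + + 3 * b) ∎

  markovTriple⇒ℤ : ∀ {b a c} → IsMarkovTriple b a c →
                   + a * + a + + b * + b + + c * + c ≡ + 3 * + a * + b * + c
  markovTriple⇒ℤ {b} {a} {c} (_ , _ , _ , eq) = begin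
    + a * + a + + b * + b + + c * + c
      ≡⟨ cong₂ _+_ (cong₂ _+_ (pos-* a a) (pos-* b b)) (pos-* c c) ⟨
    + (a ℕ.* a) + + (b ℕ.* b) + + (c ℕ.* c)
      ≡⟨ cong (_+ + (c ℕ.* c)) (pos-+ (a ℕ.* a) (b ℕ.* b)) ⟨
    + (a ℕ.* a ℕ.+ b ℕ.* b) + + (c ℕ.* c)
      ≡⟨ pos-+ (a ℕ.* a ℕ.+ b ℕ.* b) (c ℕ.* c) ⟨
    + (a ℕ.* a ℕ.+ b ℕ.* b ℕ.+ c ℕ.* c)
      ≡⟨ cong +_ reordered ⟩
    + (3 ℕ.* a ℕ.* b ℕ.* c)
      ≡⟨ pos-* (3 ℕ.* a ℕ.* b) c ⟩
    + (3 ℕ.* a ℕ.* b) * + c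
      ≡⟨ cong (_* + c) (pos-* (3 ℕ.* a) b) ⟩
    + (3 ℕ.* a) * + b * + c
      ≡⟨ cong (λ m → m * + b * + c) (pos-* 3 a) ⟩
    + 3 * + a * + b * + c ∎
    where
    open ≡-Reasoning
    reordered : a ℕ.* a ℕ.+ b ℕ.* b ℕ.+ c ℕ.* c ≡ 3 ℕ.* a ℕ.* b ℕ.* c
    reordered = begin
      a ℕ.* a ℕ.+ b ℕ.* b ℕ.+ c ℕ.* c   ≡⟨ ℕ.solve (a ∷ b ∷ c ∷ []) ⟩
      b ℕ.* b ℕ.+ a ℕ.* a ℕ.+ c ℕ.* c   ≡⟨ eq ⟩
      3 ℕ.* b ℕ.* a ℕ.* c               ≡⟨ ℕ.solve (a ∷ b ∷ c ∷ []) ⟩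
      3 ℕ.* a ℕ.* b ℕ.* c               ∎

  markovTriple⇒admissible : ∀ {b a c} → IsMarkovTriple b a c → (q : ℤ) →
                            + a Unsigned.∣ q * + b - + 3 * + c → Admissible (+ a) q (+ b) (+ c)
  markovTriple⇒admissible {b} {a} {c} m@(0<b , _ , 0<c , _) q a∣qb-3c = record
    { b-pos   = +<+ 0<b
    ; c-pos   = +<+ 0<c
    ; markov  = markovTriple⇒ℤ m
    ; a∣qb-3c = ∣ᵤ⇒∣ a∣qb-3c
    ; a∣qc+3b = ∣ᵤ⇒∣ (ℤ.coprime-divisor (+ a) (+ c) (q * + c + + 3 * + b) a⊥c
                       (∣⇒∣ᵤ (a∣c[qc+3b] {+ a} {q} {+ b} {+ c} (markovTriple⇒ℤ m) (∣ᵤ⇒∣ a∣qb-3c))))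
    }
    where
    a⊥c = proj₁ (proj₂ (markov-pairwiseCoprime m))

  admissible-bcSeq : ∀ {b a c} → IsMarkovTriple b a c → (q : ℤ) → + a Unsigned.∣ q * + b - + 3 * + c →
                     ∀ n → Admissible (+ a) q (proj₁ (bcSeq b a c n)) (proj₂ (bcSeq b a c n))
  admissible-bcSeq m q a∣ ℕ.zero    = markovTriple⇒admissible m q a∣
  admissible-bcSeq m q a∣ (ℕ.suc n) = admissible-step (admissible-bcSeq m q a∣ n)

module Barycentre where

  open import Defs
  open RationalArithmetic
  open PrimitiveDirections
  open MarkovSequence using (Admissible)
  open import Data.Integer.Divisibility.Signed using (_∣_)
  import Data.Nat.Coprimality as ℕ
  open import Data.List using (_∷_; [])
  open import Data.Product using (_×_; _,_; proj₁; proj₂)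
  open import Data.Rational using (ℚ; _+_; _*_; _-_; -_; _<_; 0ℚ; 1ℚ)
  open import Data.Rational.Properties using (*-identityʳ; +-identityʳ; *-zeroʳ)
  open import Relation.Binary.PropositionalEquality
  open import Tactic.RingSolver using (solve)

  -- Δₙᵃ and β in rational coordinates: the vertices (0 , 0), (x₂ , 0), (x₃ , y₃) and
  -- β = (βx , βy) are given by the products defining them as quotients, and T stands for 3.
  -- Each scalar n ÷ d below is chosen so that multiplying by d clears all denominators.
  module TriangleAlgebra
    (A B C T Q K x₂ x₃ y₃ βx βy : ℚ)
    (0<A : 0ℚ < A) (0<B : 0ℚ < B) (0<C : 0ℚ < C) (0<T : 0ℚ < T)
    (markov : A * A + B * B + C * C ≡ T * A * B * C)
    (qb-tc : Q * B - T * C ≡ K * A)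
    (x₂-def : x₂ * (A * B) ≡ C)
    (x₃-def : x₃ * (A * C) ≡ (Q * A - 1ℚ) * B)
    (y₃-def : y₃ * C ≡ A * B)
    (βx-def : βx * (T * A) ≡ Q)
    (βy-def : βy * T ≡ 1ℚ)
    where

    open ≡-Reasoning

    dir₁₃ : x₃ - 0ℚ ≡ (B ÷ (A * C)) * (A * Q - 1ℚ) ×
            y₃ - 0ℚ ≡ (B ÷ (A * C)) * (A * A)
    dir₁₃ = *≡*⇒≡÷* B _ AC≢0 (begin
        (x₃ - 0ℚ) * (A * C)      ≡⟨ solve (x₃ ∷ A ∷ C ∷ []) ℚring ⟩
        x₃ * (A * C)             ≡⟨ x₃-def ⟩
        (Q * A - 1ℚ) * B         ≡⟨ solve (Q ∷ A ∷ B ∷ []) ℚring ⟩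
        B * (A * Q - 1ℚ)         ∎)
      , *≡*⇒≡÷* B _ AC≢0 (begin
        (y₃ - 0ℚ) * (A * C)      ≡⟨ solve (y₃ ∷ A ∷ C ∷ []) ℚring ⟩
        y₃ * C * A               ≡⟨ cong (_* A) y₃-def ⟩
        A * B * A                ≡⟨ solve (A ∷ B ∷ []) ℚring ⟩
        B * (A * A)              ∎)
      where AC≢0 = pos⇒≢0 (*-pos 0<A 0<C)

    dir₂₃ : x₃ - x₂ ≡ ((A * A) ÷ (A * B * C)) * (B * K + 1ℚ) ×
            y₃ - 0ℚ ≡ ((A * A) ÷ (A * B * C)) * (B * B)
    dir₂₃ = *≡*⇒≡÷* (A * A) _ ABC≢0 (begin
        (x₃ - x₂) * (A * B * C)
          ≡⟨ solve (x₃ ∷ x₂ ∷ A ∷ B ∷ C ∷ []) ℚring ⟩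
        x₃ * (A * C) * B - x₂ * (A * B) * C
          ≡⟨ cong₂ (λ u v → u * B - v * C) x₃-def x₂-def ⟩
        (Q * A - 1ℚ) * B * B - C * C
          ≡⟨ solve (Q ∷ A ∷ B ∷ C ∷ T ∷ []) ℚring ⟩
        A * B * (Q * B - T * C) + T * A * B * C - (A * A + B * B + C * C) + A * A
          ≡⟨ cong₂ (λ u v → A * B * u + T * A * B * C - v + A * A) qb-tc markov ⟩
        A * B * (K * A) + T * A * B * C - T * A * B * C + A * A
          ≡⟨ solve (A ∷ B ∷ C ∷ K ∷ T ∷ []) ℚring ⟩
        A * A * (B * K + 1ℚ) ∎)
      , *≡*⇒≡÷* (A * A) _ ABC≢0 (begin
        (y₃ - 0ℚ) * (A * B * C)   ≡⟨ solve (y₃ ∷ A ∷ B ∷ C ∷ []) ℚring ⟩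
        y₃ * C * (A * B)          ≡⟨ cong (_* (A * B)) y₃-def ⟩
        A * B * (A * B)           ≡⟨ solve (A ∷ B ∷ []) ℚring ⟩
        A * A * (B * B)           ∎)
      where ABC≢0 = pos⇒≢0 (*-pos (*-pos 0<A 0<B) 0<C)

    bisector₁ : βx - 0ℚ ≡ (1ℚ ÷ (T * A * A)) * (1ℚ + (A * Q - 1ℚ)) ×
                βy - 0ℚ ≡ (1ℚ ÷ (T * A * A)) * (0ℚ + A * A)
    bisector₁ = *≡*⇒≡÷* 1ℚ _ TAA≢0 (begin
        (βx - 0ℚ) * (T * A * A)   ≡⟨ solve (βx ∷ T ∷ A ∷ []) ℚring ⟩
        βx * (T * A) * A          ≡⟨ cong (_* A) βx-def ⟩
        Q * A                     ≡⟨ solve (Q ∷ A ∷ []) ℚring ⟩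
        1ℚ * (1ℚ + (A * Q - 1ℚ))  ∎)
      , *≡*⇒≡÷* 1ℚ _ TAA≢0 (begin
        (βy - 0ℚ) * (T * A * A)   ≡⟨ solve (βy ∷ T ∷ A ∷ []) ℚring ⟩
        βy * T * (A * A)          ≡⟨ cong (_* (A * A)) βy-def ⟩
        1ℚ * (A * A)              ≡⟨ solve (A ∷ []) ℚring ⟩
        1ℚ * (0ℚ + A * A)         ∎)
      where TAA≢0 = pos⇒≢0 (*-pos (*-pos 0<T 0<A) 0<A)

    bisector₂ : βx - x₂ ≡ (A ÷ (T * A * B * B)) * ((B * K + 1ℚ) + - 1ℚ) ×
                βy - 0ℚ ≡ (A ÷ (T * A * B * B)) * (B * B + 0ℚ)
    bisector₂ = *≡*⇒≡÷* A _ TABB≢0 (begin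
        (βx - x₂) * (T * A * B * B)
          ≡⟨ solve (βx ∷ x₂ ∷ T ∷ A ∷ B ∷ []) ℚring ⟩
        βx * (T * A) * (B * B) - x₂ * (A * B) * (T * B)
          ≡⟨ cong₂ (λ u v → u * (B * B) - v * (T * B)) βx-def x₂-def ⟩
        Q * (B * B) - C * (T * B)
          ≡⟨ solve (Q ∷ B ∷ C ∷ T ∷ []) ℚring ⟩
        B * (Q * B - T * C)
          ≡⟨ cong (B *_) qb-tc ⟩
        B * (K * A)
          ≡⟨ solve (A ∷ B ∷ K ∷ []) ℚring ⟩
        A * ((B * K + 1ℚ) + - 1ℚ) ∎)
      , *≡*⇒≡÷* A _ TABB≢0 (begin
        (βy - 0ℚ) * (T * A * B * B)   ≡⟨ solve (βy ∷ T ∷ A ∷ B ∷ []) ℚring ⟩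
        βy * T * (A * B * B)          ≡⟨ cong (_* (A * B * B)) βy-def ⟩
        1ℚ * (A * B * B)              ≡⟨ solve (A ∷ B ∷ []) ℚring ⟩
        A * (B * B + 0ℚ)              ∎)
      where TABB≢0 = pos⇒≢0 (*-pos (*-pos (*-pos 0<T 0<A) 0<B) 0<B)

    bisector₃ : βx - x₃ ≡ (A ÷ (T * A * C * C)) * (- (A * Q - 1ℚ) + - (B * K + 1ℚ)) ×
                βy - y₃ ≡ (A ÷ (T * A * C * C)) * (- (A * A) + - (B * B))
    bisector₃ = *≡*⇒≡÷* A _ TACC≢0 (begin
        (βx - x₃) * (T * A * C * C)
          ≡⟨ solve (βx ∷ x₃ ∷ T ∷ A ∷ C ∷ []) ℚring ⟩
        βx * (T * A) * (C * C) - x₃ * (A * C) * (T * C)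
          ≡⟨ cong₂ (λ u v → u * (C * C) - v * (T * C)) βx-def x₃-def ⟩
        Q * (C * C) - (Q * A - 1ℚ) * B * (T * C)
          ≡⟨ solve (Q ∷ A ∷ B ∷ C ∷ T ∷ []) ℚring ⟩
        Q * (A * A + B * B + C * C) - Q * A * A - B * (Q * B - T * C) - T * Q * A * B * C
          ≡⟨ cong₂ (λ u v → Q * u - Q * A * A - B * v - T * Q * A * B * C) markov qb-tc ⟩
        Q * (T * A * B * C) - Q * A * A - B * (K * A) - T * Q * A * B * C
          ≡⟨ solve (Q ∷ A ∷ B ∷ C ∷ T ∷ K ∷ []) ℚring ⟩
        A * (- (A * Q - 1ℚ) + - (B * K + 1ℚ)) ∎)
      , *≡*⇒≡÷* A _ TACC≢0 (begin
        (βy - y₃) * (T * A * C * C)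
          ≡⟨ solve (βy ∷ y₃ ∷ T ∷ A ∷ C ∷ []) ℚring ⟩
        βy * T * (A * C * C) - y₃ * C * (T * A * C)
          ≡⟨ cong₂ (λ u v → u * (A * C * C) - v * (T * A * C)) βy-def y₃-def ⟩
        1ℚ * (A * C * C) - A * B * (T * A * C)
          ≡⟨ solve (A ∷ B ∷ C ∷ T ∷ []) ℚring ⟩
        A * (C * C) - A * (T * A * B * C)
          ≡⟨ cong (λ u → A * (C * C) - A * u) markov ⟨
        A * (C * C) - A * (A * A + B * B + C * C)
          ≡⟨ solve (A ∷ B ∷ C ∷ []) ℚring ⟩
        A * (- (A * A) + - (B * B)) ∎)
      where TACC≢0 = pos⇒≢0 (*-pos (*-pos (*-pos 0<T 0<A) 0<C) 0<C)

  module Triangle (a : ℕ.ℕ) (q b c : ℤ.ℤ) (0<a : 0 ℕ.< a) (adm : Admissible (ℤ.+ a) q b c) where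

    open Admissible adm
    open ≡-Reasoning

    -- q b − 3 c = k a is what makes (b k + 1 , b²) the primitive direction of the edge P₂P₃.
    k : ℤ.ℤ
    k = _∣_.quotient a∣qb-3c

    A B C Q K T : ℚ
    A = ℕ→ℚ a
    B = ℤ→ℚ b
    C = ℤ→ℚ c
    Q = ℤ→ℚ q
    K = ℤ→ℚ k
    T = ℕ→ℚ 3

    P₂ P₃ : Point
    P₂ = (C ÷ (A * B) , 0ℚ)
    P₃ = (((Q * A - 1ℚ) * B) ÷ (A * C) , (A * B) ÷ C)

    0<A : 0ℚ < A
    0<A = ℕ→ℚ-pos 0<a
    0<B : 0ℚ < B
    0<B = ℤ→ℚ-pos b-pos
    0<C : 0ℚ < C
    0<C = ℤ→ℚ-pos c-pos
    markovℚ : A * A + B * B + C * C ≡ T * A * B * C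
    markovℚ = begin
      A * A + B * B + C * C
        ≡⟨ cong₂ _+_ (cong₂ _+_ (ℤ→ℚ-homo-* (ℤ.+ a) (ℤ.+ a)) (ℤ→ℚ-homo-* b b)) (ℤ→ℚ-homo-* c c) ⟨
      ℤ→ℚ (ℤ.+ a ℤ.* ℤ.+ a) + ℤ→ℚ (b ℤ.* b) + ℤ→ℚ (c ℤ.* c)
        ≡⟨ cong (_+ ℤ→ℚ (c ℤ.* c)) (ℤ→ℚ-homo-+ (ℤ.+ a ℤ.* ℤ.+ a) (b ℤ.* b)) ⟨
      ℤ→ℚ (ℤ.+ a ℤ.* ℤ.+ a ℤ.+ b ℤ.* b) + ℤ→ℚ (c ℤ.* c)
        ≡⟨ ℤ→ℚ-homo-+ (ℤ.+ a ℤ.* ℤ.+ a ℤ.+ b ℤ.* b) (c ℤ.* c) ⟨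
      ℤ→ℚ (ℤ.+ a ℤ.* ℤ.+ a ℤ.+ b ℤ.* b ℤ.+ c ℤ.* c)
        ≡⟨ cong ℤ→ℚ markov ⟩
      ℤ→ℚ (ℤ.+ 3 ℤ.* ℤ.+ a ℤ.* b ℤ.* c)
        ≡⟨ ℤ→ℚ-homo-* (ℤ.+ 3 ℤ.* ℤ.+ a ℤ.* b) c ⟩
      ℤ→ℚ (ℤ.+ 3 ℤ.* ℤ.+ a ℤ.* b) * C
        ≡⟨ cong (_* C) (ℤ→ℚ-homo-* (ℤ.+ 3 ℤ.* ℤ.+ a) b) ⟩
      ℤ→ℚ (ℤ.+ 3 ℤ.* ℤ.+ a) * B * C
        ≡⟨ cong (λ t → t * B * C) (ℤ→ℚ-homo-* (ℤ.+ 3) (ℤ.+ a)) ⟩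
      T * A * B * C ∎

    qb-tc : Q * B - T * C ≡ K * A
    qb-tc = begin
      Q * B - T * C                        ≡⟨ cong₂ _-_ (ℤ→ℚ-homo-* q b) (ℤ→ℚ-homo-* (ℤ.+ 3) c) ⟨
      ℤ→ℚ (q ℤ.* b) - ℤ→ℚ (ℤ.+ 3 ℤ.* c)    ≡⟨ ℤ→ℚ-homo-sub (q ℤ.* b) (ℤ.+ 3 ℤ.* c) ⟨
      ℤ→ℚ (q ℤ.* b ℤ.- ℤ.+ 3 ℤ.* c)        ≡⟨ cong ℤ→ℚ (_∣_.equality a∣qb-3c) ⟩
      ℤ→ℚ (k ℤ.* ℤ.+ a)                    ≡⟨ ℤ→ℚ-homo-* k (ℤ.+ a) ⟩
      K * A                                ∎

    module Alg = TriangleAlgebra A B C T Q K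
      (proj₁ P₂) (proj₁ P₃) (proj₂ P₃) (proj₁ (β a q)) (proj₂ (β a q)) 0<A 0<B 0<C 0<3 markovℚ qb-tc
      (p÷q*q≡p C (pos⇒≢0 (*-pos 0<A 0<B)))
      (p÷q*q≡p ((Q * A - 1ℚ) * B) (pos⇒≢0 (*-pos 0<A 0<C)))
      (p÷q*q≡p (A * B) (pos⇒≢0 0<C))
      (p÷q*q≡p Q (pos⇒≢0 (*-pos 0<3 0<A)))
      (p÷q*q≡p 1ℚ (pos⇒≢0 0<3))

    v₁₂ v₁₃ v₂₃ : IntVec
    v₁₂ = (ℤ.+ 1 , ℤ.+ 0)
    v₁₃ = (ℤ.+ a ℤ.* q ℤ.- ℤ.+ 1 , ℤ.+ a ℤ.* ℤ.+ a)
    v₂₃ = (b ℤ.* k ℤ.+ ℤ.+ 1 , b ℤ.* b)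

    v₁₃-cast : ℤ→ℚ (proj₁ v₁₃) ≡ A * Q - 1ℚ × ℤ→ℚ (proj₂ v₁₃) ≡ A * A
    v₁₃-cast = trans (ℤ→ℚ-homo-sub (ℤ.+ a ℤ.* q) (ℤ.+ 1)) (cong (_- 1ℚ) (ℤ→ℚ-homo-* (ℤ.+ a) q))
             , ℤ→ℚ-homo-* (ℤ.+ a) (ℤ.+ a)

    v₂₃-cast : ℤ→ℚ (proj₁ v₂₃) ≡ B * K + 1ℚ × ℤ→ℚ (proj₂ v₂₃) ≡ B * B
    v₂₃-cast = trans (ℤ→ℚ-homo-+ (b ℤ.* k) (ℤ.+ 1)) (cong (_+ 1ℚ) (ℤ→ℚ-homo-* b k))
             , ℤ→ℚ-homo-* b b

    dir₁₂ : IsPrimitiveDir Δ-vertex₁ P₂ v₁₂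
    dir₁₂ = ℕ.1-coprimeTo 0 , proj₁ P₂ , ÷-pos 0<C (*-pos 0<A 0<B) ,
            trans (+-identityʳ (proj₁ P₂)) (sym (*-identityʳ (proj₁ P₂))) , sym (*-zeroʳ (proj₁ P₂))

    dir₁₃ : IsPrimitiveDir Δ-vertex₁ P₃ v₁₃
    dir₁₃ = coprime[x*y+e,x*x] (ℤ.+ a) q (ℤ.- ℤ.+ 1) refl , t , ÷-pos 0<B (*-pos 0<A 0<C) ,
            trans (proj₁ Alg.dir₁₃) (cong (t *_) (sym (proj₁ v₁₃-cast))) ,
            trans (proj₂ Alg.dir₁₃) (cong (t *_) (sym (proj₂ v₁₃-cast)))
      where t = B ÷ (A * C)

    dir₂₃ : IsPrimitiveDir P₂ P₃ v₂₃
    dir₂₃ = coprime[x*y+e,x*x] b k (ℤ.+ 1) refl , t , ÷-pos (*-pos 0<A 0<A) (*-pos (*-pos 0<A 0<B) 0<C) ,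
            trans (proj₁ Alg.dir₂₃) (cong (t *_) (sym (proj₁ v₂₃-cast))) ,
            trans (proj₂ Alg.dir₂₃) (cong (t *_) (sym (proj₂ v₂₃-cast)))
      where t = (A * A) ÷ (A * B * C)

    bisector₁ : OnIntegralBisector Δ-vertex₁ P₂ P₃ (β a q)
    bisector₁ = onIntegralBisector-intro Δ-vertex₁ P₂ P₃ (β a q) {v₁₂} {v₁₃} s dir₁₂ dir₁₃
      (trans (proj₁ Alg.bisector₁) (cong (λ w → s * (1ℚ + w)) (sym (proj₁ v₁₃-cast))))
      (trans (proj₂ Alg.bisector₁) (cong (λ w → s * (0ℚ + w)) (sym (proj₂ v₁₃-cast))))
      where s = 1ℚ ÷ (T * A * A)

    bisector₂ : OnIntegralBisector P₂ P₃ Δ-vertex₁ (β a q)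
    bisector₂ = onIntegralBisector-intro P₂ P₃ Δ-vertex₁ (β a q) {v₂₃} {opposite v₁₂} s
      dir₂₃ (primitiveDir-flip Δ-vertex₁ P₂ {v₁₂} dir₁₂)
      (trans (proj₁ Alg.bisector₂) (cong (λ w → s * (w + - 1ℚ)) (sym (proj₁ v₂₃-cast))))
      (trans (proj₂ Alg.bisector₂) (cong (λ w → s * (w + 0ℚ)) (sym (proj₂ v₂₃-cast))))
      where s = A ÷ (T * A * B * B)

    bisector₃ : OnIntegralBisector P₃ Δ-vertex₁ P₂ (β a q)
    bisector₃ = onIntegralBisector-intro P₃ Δ-vertex₁ P₂ (β a q) {opposite v₁₃} {opposite v₂₃} s
      (primitiveDir-flip Δ-vertex₁ P₃ {v₁₃} dir₁₃) (primitiveDir-flip P₂ P₃ {v₂₃} dir₂₃)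
      (trans (proj₁ Alg.bisector₃) (cong₂ (λ v w → s * (v + w))
        (sym (neg (proj₁ v₁₃) (proj₁ v₁₃-cast))) (sym (neg (proj₁ v₂₃) (proj₁ v₂₃-cast)))))
      (trans (proj₂ Alg.bisector₃) (cong₂ (λ v w → s * (v + w))
        (sym (neg (proj₂ v₁₃) (proj₂ v₁₃-cast))) (sym (neg (proj₂ v₂₃) (proj₂ v₂₃-cast)))))
      where
      s = A ÷ (T * A * C * C)
      neg : ∀ z {Z} → ℤ→ℚ z ≡ Z → ℤ→ℚ (ℤ.- z) ≡ - Z
      neg z eq = trans (ℤ→ℚ-homo-neg z) (cong -_ eq)

    isIntegralBarycentre : IsIntegralBarycentre Δ-vertex₁ P₂ P₃ (β a q)
    isIntegralBarycentre = bisector₁ , bisector₂ , bisector₃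

module LineD∞ where

  open import Defs
  open RationalArithmetic
  open import Data.List using (_∷_; [])
  open import Data.Product using (_×_; _,_)
  open import Data.Product.Properties using (,-injectiveˡ; ,-injectiveʳ)
  open import Data.Rational using (ℚ; _+_; _*_; _-_; _<_; 0ℚ; 1ℚ)
  open import Function.Bundles using (_⇔_; mk⇔)
  open import Relation.Binary.PropositionalEquality
  open import Tactic.RingSolver using (solve)

  embed-mulQ : ∀ d r s t → mulQ d (embed r) (s , t) ≡ (r * s , r * t)
  embed-mulQ d r s t = cong₂ _,_ rational irrational
    where
    rational : r * s + d * (0ℚ * t) ≡ r * s
    rational = solve (d ∷ r ∷ s ∷ t ∷ []) ℚring
    irrational : r * t + 0ℚ * s ≡ r * t
    irrational = solve (r ∷ s ∷ t ∷ []) ℚring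

  mulQ-embed : ∀ d s t r → mulQ d (s , t) (embed r) ≡ (s * r , t * r)
  mulQ-embed d s t r = cong₂ _,_ rational irrational
    where
    rational : s * r + d * (t * 0ℚ) ≡ s * r
    rational = solve (d ∷ r ∷ s ∷ t ∷ []) ℚring
    irrational : s * 0ℚ + t * r ≡ t * r
    irrational = solve (r ∷ s ∷ t ∷ []) ℚring

  ⊖-embed : ∀ r s t → (r , s) ⊖ embed t ≡ (r - t , s)
  ⊖-embed r s t = cong (r - t ,_) (solve (s ∷ []) ℚring)

  λ₁ λ₂ : ℚ
  λ₁ = ℕ→ℚ 3 ÷ ℕ→ℚ 2
  λ₂ = 1ℚ ÷ ℕ→ℚ 2

  -- u stands for 4/a², so that mulQ (ℕ→ℚ 9 - u) is multiplication in ℚ(√δ a).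
  module QuadraticLine (A Q u : ℚ) (0<A : 0ℚ < A) (u-def : u * (A * A) ≡ ℕ→ℚ 4) where

    open ≡-Reasoning

    private
      _⊛_ = mulQ (ℕ→ℚ 9 - u)
      a² = embed (A * A)
      λa : Quad
      λa = (λ₁ , λ₂)

    a²λ²≡3a²λ-1 : a² ⊛ (λa ⊛ λa) ≡ (ℕ→ℚ 3 * (A * A) * λ₁ - 1ℚ , ℕ→ℚ 3 * (A * A) * λ₂)
    a²λ²≡3a²λ-1 =
      trans (embed-mulQ (ℕ→ℚ 9 - u) (A * A) _ _) (cong₂ _,_ rational (solve (A ∷ []) ℚring))
      where
      rational : A * A * (λ₁ * λ₁ + (ℕ→ℚ 9 - u) * (λ₂ * λ₂)) ≡ ℕ→ℚ 3 * (A * A) * λ₁ - 1ℚ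
      rational = begin
        A * A * (λ₁ * λ₁ + (ℕ→ℚ 9 - u) * (λ₂ * λ₂))
          ≡⟨ solve (A ∷ u ∷ []) ℚring ⟩
        ℕ→ℚ 3 * (A * A) * λ₁ - u * (A * A) * (λ₂ * λ₂)
          ≡⟨ cong (λ w → ℕ→ℚ 3 * (A * A) * λ₁ - w * (λ₂ * λ₂)) u-def ⟩
        ℕ→ℚ 3 * (A * A) * λ₁ - ℕ→ℚ 4 * (λ₂ * λ₂)
          ≡⟨ solve (A ∷ []) ℚring ⟩
        ℕ→ℚ 3 * (A * A) * λ₁ - 1ℚ ∎

    lhs : ℚ → ℚ → Quad
    lhs x y = (a² ⊛ embed x) ⊕ (((a² ⊛ (λa ⊛ λa)) ⊖ embed (Q * A - 1ℚ)) ⊛ embed y)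

    lhs≡ : ∀ x y →
      lhs x y ≡ (A * A * x + (ℕ→ℚ 3 * (A * A) * λ₁ - Q * A) * y , ℕ→ℚ 3 * (A * A) * λ₂ * y)
    lhs≡ x y = begin
      lhs x y
        ≡⟨ cong₂ _⊕_ (embed-mulQ (ℕ→ℚ 9 - u) (A * A) x 0ℚ)
                     (cong (λ P → (P ⊖ embed (Q * A - 1ℚ)) ⊛ embed y) a²λ²≡3a²λ-1) ⟩
      (A * A * x , A * A * 0ℚ) ⊕ (((3a²λ₁ - 1ℚ , 3a²λ₂) ⊖ embed (Q * A - 1ℚ)) ⊛ embed y)
        ≡⟨ cong (λ P → (A * A * x , A * A * 0ℚ) ⊕ (P ⊛ embed y))
                (⊖-embed (3a²λ₁ - 1ℚ) 3a²λ₂ (Q * A - 1ℚ)) ⟩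
      (A * A * x , A * A * 0ℚ) ⊕ ((3a²λ₁ - 1ℚ - (Q * A - 1ℚ) , 3a²λ₂) ⊛ embed y)
        ≡⟨ cong ((A * A * x , A * A * 0ℚ) ⊕_)
                (mulQ-embed (ℕ→ℚ 9 - u) (3a²λ₁ - 1ℚ - (Q * A - 1ℚ)) 3a²λ₂ y) ⟩
      (A * A * x + (3a²λ₁ - 1ℚ - (Q * A - 1ℚ)) * y , A * A * 0ℚ + 3a²λ₂ * y)
        ≡⟨ cong₂ _,_ (rational 3a²λ₁) (irrational (3a²λ₂ * y)) ⟩
      (A * A * x + (ℕ→ℚ 3 * (A * A) * λ₁ - Q * A) * y , ℕ→ℚ 3 * (A * A) * λ₂ * y) ∎
      where
      3a²λ₁ = ℕ→ℚ 3 * (A * A) * λ₁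
      3a²λ₂ = ℕ→ℚ 3 * (A * A) * λ₂
      rational : ∀ r → A * A * x + (r - 1ℚ - (Q * A - 1ℚ)) * y ≡ A * A * x + (r - Q * A) * y
      rational r = solve (r ∷ A ∷ Q ∷ x ∷ y ∷ []) ℚring
      irrational : ∀ r → A * A * 0ℚ + r ≡ r
      irrational r = solve (r ∷ A ∷ []) ℚring

    rhs≡ : a² ⊛ λa ≡ (A * A * λ₁ , A * A * λ₂)
    rhs≡ = embed-mulQ (ℕ→ℚ 9 - u) (A * A) λ₁ λ₂

    on-line⇒β : ∀ x y → lhs x y ≡ a² ⊛ λa → x ≡ Q ÷ (ℕ→ℚ 3 * A) × y ≡ 1ℚ ÷ ℕ→ℚ 3
    on-line⇒β x y on-line =
      *≡⇒≡÷ Q (pos⇒≢0 (*-pos 0<3 0<A)) x*3A≡Q , *≡⇒≡÷ 1ℚ (pos⇒≢0 0<3) y*3≡1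
      where
      components = trans (sym (lhs≡ x y)) (trans on-line rhs≡)
      y*3≡1 : y * ℕ→ℚ 3 ≡ 1ℚ
      y*3≡1 = *-cancelʳ-≡ (A * A) (pos⇒≢0 (*-pos 0<A 0<A)) (begin
        y * ℕ→ℚ 3 * (A * A)                     ≡⟨ solve (y ∷ A ∷ []) ℚring ⟩
        ℕ→ℚ 2 * (ℕ→ℚ 3 * (A * A) * λ₂ * y)      ≡⟨ cong (ℕ→ℚ 2 *_) (,-injectiveʳ components) ⟩
        ℕ→ℚ 2 * (A * A * λ₂)                    ≡⟨ solve (A ∷ []) ℚring ⟩
        1ℚ * (A * A)                            ∎)
      x*3A≡Q : x * (ℕ→ℚ 3 * A) ≡ Q
      x*3A≡Q = *-cancelʳ-≡ A (pos⇒≢0 0<A) (begin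
        x * (ℕ→ℚ 3 * A) * A
          ≡⟨ solve (x ∷ y ∷ A ∷ Q ∷ []) ℚring ⟩
        ℕ→ℚ 3 * (A * A * x + (ℕ→ℚ 3 * (A * A) * λ₁ - Q * A) * y)
          - (ℕ→ℚ 3 * (A * A) * λ₁ - Q * A) * (y * ℕ→ℚ 3)
          ≡⟨ cong₂ (λ l r → ℕ→ℚ 3 * l - (ℕ→ℚ 3 * (A * A) * λ₁ - Q * A) * r)
                   (,-injectiveˡ components) y*3≡1 ⟩
        ℕ→ℚ 3 * (A * A * λ₁) - (ℕ→ℚ 3 * (A * A) * λ₁ - Q * A) * 1ℚ
          ≡⟨ solve (A ∷ Q ∷ []) ℚring ⟩
        Q * A ∎)

    β-on-line : ∀ x → x * (ℕ→ℚ 3 * A) ≡ Q → lhs x (1ℚ ÷ ℕ→ℚ 3) ≡ a² ⊛ λa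
    β-on-line x x*3A≡Q = trans (lhs≡ x (1ℚ ÷ ℕ→ℚ 3))
      (trans (cong₂ _,_ rational (solve (A ∷ []) ℚring)) (sym rhs≡))
      where
      rational : A * A * x + (ℕ→ℚ 3 * (A * A) * λ₁ - Q * A) * (1ℚ ÷ ℕ→ℚ 3) ≡ A * A * λ₁
      rational = begin
        A * A * x + (ℕ→ℚ 3 * (A * A) * λ₁ - Q * A) * (1ℚ ÷ ℕ→ℚ 3)
          ≡⟨ solve (x ∷ A ∷ Q ∷ []) ℚring ⟩
        (x * (ℕ→ℚ 3 * A) * A + ℕ→ℚ 3 * (A * A) * λ₁ - Q * A) * (1ℚ ÷ ℕ→ℚ 3)
          ≡⟨ cong (λ l → (l * A + ℕ→ℚ 3 * (A * A) * λ₁ - Q * A) * (1ℚ ÷ ℕ→ℚ 3)) x*3A≡Q ⟩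
        (Q * A + ℕ→ℚ 3 * (A * A) * λ₁ - Q * A) * (1ℚ ÷ ℕ→ℚ 3)
          ≡⟨ solve (A ∷ Q ∷ []) ℚring ⟩
        A * A * λ₁ ∎

    on-line⇔β : ∀ x y → (lhs x y ≡ a² ⊛ λa) ⇔ ((x , y) ≡ (Q ÷ (ℕ→ℚ 3 * A) , 1ℚ ÷ ℕ→ℚ 3))
    on-line⇔β x y = mk⇔ (λ on-line → let (x≡ , y≡) = on-line⇒β x y on-line in cong₂ _,_ x≡ y≡)
                        (λ { refl → β-on-line _ (p÷q*q≡p Q (pos⇒≢0 (*-pos 0<3 0<A))) })

  onD∞⇔β : ∀ {a} → 0 ℕ.< a → (q : ℤ.ℤ) (P : Point) → OnD∞ a q P ⇔ (P ≡ β a q)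
  onD∞⇔β {a} 0<a q (x , y) =
    QuadraticLine.on-line⇔β (ℕ→ℚ a) (ℤ→ℚ q) (ℕ→ℚ 4 ÷ (ℕ→ℚ a * ℕ→ℚ a)) (ℕ→ℚ-pos 0<a)
      (p÷q*q≡p (ℕ→ℚ 4) (pos⇒≢0 (*-pos (ℕ→ℚ-pos 0<a) (ℕ→ℚ-pos 0<a)))) x y

open import Defs
open import Data.Nat using (ℕ; _≤_)
open import Data.Integer using (ℤ; +_; _*_; _-_)
open import Data.Integer.Divisibility using (_∣_)
open import Data.Product using (_×_)
open import Function.Bundles using (_⇔_)
open import Relation.Binary.PropositionalEquality using (_≡_)

open import Data.Product using (_,_; proj₁; proj₂)
open MarkovSequence using (admissible-bcSeq)
open Barycentre using (module Triangle)
open LineD∞ using (onD∞⇔β)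

mainTheorem15 : (b a c : ℕ) → IsMarkovTriple b a c → b ≤ a → c ≤ a →
    (q : ℤ) → (+ a) ∣ (q * + b - + 3 * + c) →
    ((P : Point) → OnD∞ a q P ⇔ (P ≡ β a q)) ×
    ((n : ℕ) → IsIntegralBarycentre Δ-vertex₁ (Δ-vertex₂ b a c n) (Δ-vertex₃ b a c q n) (β a q))
mainTheorem15 b a c markov _ _ q a∣qb-3c =
  onD∞⇔β 0<a q ,
  λ n → Triangle.isIntegralBarycentre a q _ _ 0<a (admissible-bcSeq markov q a∣qb-3c n)
  where
  0<a = proj₁ (proj₂ markov)
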